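{- Let $G$ be a $5/4$-structured graph and $S$ a canonical 2-edge cover of $G$ all of whose components are 2EC. Let $B$ be a 2VC block of the component graph $\hat G_S$, and let $(\hat V_1,\hat V_2)$ be a partition of the nodes of $B$ with $\hat V_1\neq\emptyset\neq\hat V_2$. For $i\in\{1,2\}$ let $V_i=\bigcup_{\hat C\in\hat V_i}V(C)$ be the set of vertices of $G$ corresponding to $\hat V_i$. Then $G$ contains a matching of size $3$ consisting of edges with one endpoint in $V_1$ and the other in $V_2$.
   Context: A graph is 2EC if it is connected and remains connected after deleting any edge; 2VC if connected, at least three vertices, no cut vertex. For $\alpha>1$, $G$ is $\alpha$-structured if it is simple, 2VC, has at least $\frac{4}{\alpha-1}$ vertices, has no $\alpha$-contractible subgraph with at most $\frac{2}{\alpha-1}$ vertices (a 2EC subgraph $C$ such that every 2EC spanning subgraph of $G$ contains at least $|E(C)|/\alpha$ edges of $G[V(C)]$), has no edge $uv$ with $\{u,v\}$ a 2-vertex cut, and every 2-vertex cut $\{u,v\}$ leaves exactly two components one of which is a single vertex. A 2-edge cover is $S\subseteq E(G)$ with every vertex incident to at least two edges of $S$; components are those of $(V(G),S)$. $S$ is canonical if (1) no component is a triangle, (2) every component with fewer than 8 edges is a cycle, (3) every maximal 2EC subgraph (with at least one edge) of a non-2EC component has at least 4 edges, (4) every non-2EC component has at least two such maximal 2EC subgraphs with at least 6 edges each, (5) some component has at least 8 vertices. The component graph $\hat G_S$ is the multigraph obtained from $G$ by contracting the vertex set of each component $C$ of $S$ into a single node $\hat C$ and deleting loops (parallel edges are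 kept); each edge of $\hat G_S$ corresponds to an edge of $G$. A 2VC block of $\hat G_S$ is a block of its block–cut-vertex decomposition, i.e., a maximal connected subgraph with at least two nodes that has no cut node (parallel edges allowed). -}

module Defs where

open import Data.Nat using (ℕ; _+_; _*_; _∸_; _≤_)
open import Data.Fin using (Fin)
open import Data.Fin.Properties using (_≟_)
open import Data.Bool using (Bool; _∧_; _∨_)
open import Data.Vec using (tabulate; lookup)
open import Data.Fin.Subset using (Subset; _∈_; _∉_; _⊆_; _-_; ∣_∣; Nonempty)
  renaming (⊤ to full)
open import Data.Product using (Σ; ∃; ∃-syntax; _×_; _,_; proj₁; proj₂)
open import Data.Sum using (_⊎_)
open import Data.Empty using (⊥)
open import Relation.Nullary using (¬_)
open import Relation.Nullary.Decidable using (⌊_⌋)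
open import Relation.Binary.PropositionalEquality using (_≡_; _≢_)
open import Function.Bundles using (_⇔_)

-- Subgraphs are given by a vertex subset VS and an edge
-- subset ES; only edges in ES with both endpoints in VS are used.

record Graph : Set where
  field
    n    : ℕ
    m    : ℕ
    ends : Fin m → Fin n × Fin n

module _ (G : Graph) where
  open Graph G

  src tgt : Fin m → Fin n
  src e = proj₁ (ends e)
  tgt e = proj₂ (ends e)

  Joins : Fin m → Fin n → Fin n → Set
  Joins e u w = (src e ≡ u × tgt e ≡ w) ⊎ (src e ≡ w × tgt e ≡ u)

  EdgeIn : Subset n → Subset m → Fin m → Set
  EdgeIn VS ES e = e ∈ ES × src e ∈ VS × tgt e ∈ VS

  edgesIn : Subset n → Subset m → Subset m
  edgesIn VS ES = tabulate λ e → lookup ES e ∧ lookup VS (src e) ∧ lookup VS (tgt e)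

  #E : Subset n → Subset m → ℕ
  #E VS ES = ∣ edgesIn VS ES ∣

  deg : Subset n → Subset m → Fin n → ℕ
  deg VS ES v = ∣ tabulate (λ e → lookup (edgesIn VS ES) e
                   ∧ (⌊ src e ≟ v ⌋ ∨ ⌊ tgt e ≟ v ⌋)) ∣

  data Walk (VS : Subset n) (ES : Subset m) : Fin n → Fin n → Set where
    here : ∀ {u} → u ∈ VS → Walk VS ES u u
    step : ∀ {u w v} (e : Fin m) → EdgeIn VS ES e → Joins e u w →
           Walk VS ES w v → Walk VS ES u v

  Connected : Subset n → Subset m → Set
  Connected VS ES = ∀ u v → u ∈ VS → v ∈ VS → Walk VS ES u v

  TwoEC : Subset n → Subset m → Set
  TwoEC VS ES = Connected VS ES × (∀ e → EdgeIn VS ES e → Connected VS (ES - e))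

  NoCutVertex : Subset n → Subset m → Set
  NoCutVertex VS ES = ∀ w → w ∈ VS → Connected (VS - w) ES

  TwoVC : Subset n → Subset m → Set
  TwoVC VS ES = Connected VS ES × 3 ≤ ∣ VS ∣ × NoCutVertex VS ES

  SubOf : Subset n → Subset m → Subset n → Subset m → Set
  SubOf VS ES VS' ES' = VS ⊆ VS' × edgesIn VS ES ⊆ edgesIn VS' ES'

  Simple : Set
  Simple = (∀ e → src e ≢ tgt e) ×
           (∀ e f u v → Joins e u v → Joins f u v → e ≡ f)

  -- α-structured graphs, for α = p / q (p > q > 0)

  Contractible : ℕ → ℕ → Subset n → Subset m → Set
  Contractible p q VC EC =
    1 ≤ #E VC EC × TwoEC VC EC ×
    (∀ (H : Subset m) → TwoEC full H → q * #E VC EC ≤ p * #E VC H)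

  TwoVertexCut : Fin n → Fin n → Set
  TwoVertexCut u v = u ≢ v × ¬ Connected ((full - u) - v) full

  -- G - {u,v} has exactly two components, one of which is the single
  -- vertex w.
  TwoCompsOneSingleton : Fin n → Fin n → Set
  TwoCompsOneSingleton u v =
    ∃[ w ] (w ≢ u × w ≢ v ×
            (∀ x e → x ≢ u → x ≢ v → x ≢ w → ¬ Joins e w x) ×
            Nonempty (((full - u) - v) - w) ×
            Connected (((full - u) - v) - w) full)

  Structured : ℕ → ℕ → Set
  Structured p q =
    Simple ×
    TwoVC full full ×
    4 * q ≤ (p ∸ q) * n ×
    (∀ VC EC → ∣ VC ∣ * (p ∸ q) ≤ 2 * q → ¬ Contractible p q VC EC) ×
    (∀ e → ¬ TwoVertexCut (src e) (tgt e)) ×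
    (∀ u v → TwoVertexCut u v → TwoCompsOneSingleton u v)

  TwoEdgeCover : Subset m → Set
  TwoEdgeCover S = ∀ v → 2 ≤ deg full S v

  -- VC is (the vertex set of) a connected component of (V(G) , S);
  -- the component itself is the subgraph (VC , S).
  IsComponent : Subset m → Subset n → Set
  IsComponent S VC =
    Nonempty VC × Connected VC S ×
    (∀ e u w → e ∈ S → Joins e u w → u ∈ VC → w ∈ VC)

  IsCycle : Subset n → Subset m → Set
  IsCycle VS ES = Nonempty VS × Connected VS ES × (∀ v → v ∈ VS → deg VS ES v ≡ 2)

  IsTriangle : Subset n → Subset m → Set
  IsTriangle VS ES = ∣ VS ∣ ≡ 3 × IsCycle VS ES

  Maximal2EC : Subset n → Subset m → Subset n → Subset m → Set
  Maximal2EC VC EC VH EH =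
    SubOf VH EH VC EC × TwoEC VH EH × 1 ≤ #E VH EH ×
    (∀ VH' EH' → SubOf VH EH VH' EH' → SubOf VH' EH' VC EC →
       TwoEC VH' EH' → SubOf VH' EH' VH EH)

  Canonical : Subset m → Set
  Canonical S =
    (∀ VC → IsComponent S VC → ¬ IsTriangle VC S) ×
    (∀ VC → IsComponent S VC → #E VC S ≤ 7 → IsCycle VC S) ×
    (∀ VC → IsComponent S VC → ¬ TwoEC VC S →
       ∀ VH EH → Maximal2EC VC S VH EH → 4 ≤ #E VH EH) ×
    (∀ VC → IsComponent S VC → ¬ TwoEC VC S →
       Σ (Subset n × Subset m) λ H₁ → Σ (Subset n × Subset m) λ H₂ →
         Maximal2EC VC S (proj₁ H₁) (proj₂ H₁) ×
         Maximal2EC VC S (proj₁ H₂) (proj₂ H₂) ×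
         6 ≤ #E (proj₁ H₁) (proj₂ H₁) × 6 ≤ #E (proj₁ H₂) (proj₂ H₂) ×
         ¬ (SubOf (proj₁ H₁) (proj₂ H₁) (proj₁ H₂) (proj₂ H₂) ×
            SubOf (proj₁ H₂) (proj₂ H₂) (proj₁ H₁) (proj₂ H₁))) ×
    (∃[ VC ] (IsComponent S VC × 8 ≤ ∣ VC ∣))

-- Its nodes are Fin k, given by a surjective
-- labelling φ : V(G) → Fin k whose fibres are exactly the components of
-- (V(G) , S).  Its edges are the edges of G (same index set Fin m), with
-- endpoints mapped by φ; loops (edges inside a component) are deleted,
-- which we implement by only allowing subgraphs whose edge set consists
-- of non-loop edges.

module _ (G : Graph) where
  open Graph G

  IsComponentLabelling : Subset m → (k : ℕ) → (Fin n → Fin k) → Set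
  IsComponentLabelling S k φ =
    (∀ x → ∃[ v ] φ v ≡ x) ×
    (∀ u v → (φ u ≡ φ v) ⇔ Walk G full S u v)

  contract : (k : ℕ) → (Fin n → Fin k) → Graph
  contract k φ = record { n = k ; m = m ; ends = λ e → φ (src G e) , φ (tgt G e) }

  LoopFree : (k : ℕ) → (Fin n → Fin k) → Subset m → Set
  LoopFree k φ EB = ∀ e → e ∈ EB → φ (src G e) ≢ φ (tgt G e)

  BlockCand : (k : ℕ) → (Fin n → Fin k) → Subset k → Subset m → Set
  BlockCand k φ VB EB =
    LoopFree k φ EB × 2 ≤ ∣ VB ∣ ×
    Connected (contract k φ) VB EB × NoCutVertex (contract k φ) VB EB

  IsBlock : (k : ℕ) → (Fin n → Fin k) → Subset k → Subset m → Set
  IsBlock k φ VB EB =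
    BlockCand k φ VB EB ×
    (∀ VB' EB' → SubOf (contract k φ) VB EB VB' EB' → BlockCand k φ VB' EB' →
       SubOf (contract k φ) VB' EB' VB EB)

  Crossing : (Fin n → Set) → (Fin n → Set) → Fin m → Set
  Crossing V₁ V₂ e = (V₁ (src G e) × V₂ (tgt G e)) ⊎ (V₂ (src G e) × V₁ (tgt G e))

  Disjoint : Fin m → Fin m → Set
  Disjoint e f = src G e ≢ src G f × src G e ≢ tgt G f ×
                 tgt G e ≢ src G f × tgt G e ≢ tgt G f

-- Call an edge crossing if it joins V₁ and V₂.  By König's theorem it suffices to rule out two
-- vertices u ≠ v meeting every crossing edge.  Every component of S has at least three vertices
-- (a vertex and its two S-neighbours in a simple graph), so G − u − v meets every component and
-- has no crossing edge.  A walk in it from V₁ to V₂ would map to a walk of Ĝ_S from V̂₁ to V̂₂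
-- without crossing edges; such a walk has to leave B and re-enter it at another node, and the
-- path outside B between the two would enlarge B to a bigger 2-connected subgraph.  Hence
-- {u, v} is a 2-vertex cut.  It is not an edge, so G − u − v has a singleton component w; the
-- two S-neighbours of w are then u and v, and the same argument applies to the connected graph
-- G − u − v − w.

module Submission where

open import Data.Bool using (Bool; T; _∧_; _∨_)
open import Data.Bool.Properties using (T-≡; T-∧; T-∨)
open import Data.Empty using (⊥; ⊥-elim)
open import Data.Fin using (Fin; zero; suc)
open import Data.Fin.Properties using (_≟_; any?; suc-injective)
open import Data.Fin.Subset
  using (Subset; _∈_; _∉_; _⊆_; _─_; _-_; _∪_; ∣_∣; Nonempty; inside; outside; ⁅_⁆)
  renaming (⊤ to full)
open import Data.Fin.Subset.Properties
  using (_∈?_; ∈⊤; x∈⁅x⁆; p─q⊆p; x∈p∧x≢y⇒x∈p-y; p⊆p∪q; x∈p∪q⁺; x∈p∪q⁻; p⊆q⇒∣p∣≤∣q∣)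
open import Data.Nat using (ℕ; _≤_; s≤s)
open import Data.Nat.Properties using (≤-trans)
open import Data.Product using (Σ-syntax; ∃₂; ∃-syntax; _×_; _,_; proj₁; proj₂)
open import Data.Sum using (_⊎_; inj₁; inj₂; [_,_]; swap)
import Data.Sum as Sum
open import Data.Unit using (⊤; tt)
open import Data.Vec using (_∷_; here; there; lookup; tabulate)
open import Data.Vec.Properties using (lookup∘tabulate; []=⇒lookup; lookup⇒[]=)
open import Function using (_∘_)
open import Function.Bundles using (_⇔_; mk⇔; Equivalence)
open import Relation.Nullary using (¬_; Dec; yes; no)
open import Relation.Nullary.Decidable using (⌊_⌋; toWitness; fromWitness; _×-dec_; _⊎-dec_; ¬?)
open import Relation.Binary.PropositionalEquality
  using (_≡_; _≢_; refl; sym; trans; subst; ≢-sym)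

open import Defs

open Equivalence using (to; from)

x∈p─q⇒x∉q : ∀ {n} (p q : Subset n) {x} → x ∈ p ─ q → x ∉ q
x∈p─q⇒x∉q (inside ∷ p) (outside ∷ q) here       ()
x∈p─q⇒x∉q (_ ∷ p)      (_ ∷ q)       (there x∈) (there y∈) = x∈p─q⇒x∉q p q x∈ y∈

∈-y⇔ : ∀ {n} {p : Subset n} {x y} → x ∈ p - y ⇔ (x ∈ p × x ≢ y)
∈-y⇔ {p = p} {y = y} = mk⇔
  (λ x∈ → p─q⊆p p ⁅ y ⁆ x∈ , λ { refl → x∈p─q⇒x∉q p ⁅ y ⁆ x∈ (x∈⁅x⁆ y) })
  (λ (x∈p , x≢y) → x∈p∧x≢y⇒x∈p-y x∈p x≢y)

∈⊤-u-v⇔ : ∀ {n} {x u v : Fin n} → x ∈ full - u - v ⇔ (x ≢ u × x ≢ v)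
∈⊤-u-v⇔ = mk⇔
  (λ x∈ → proj₂ (to ∈-y⇔ (proj₁ (to ∈-y⇔ x∈))) , proj₂ (to ∈-y⇔ x∈))
  (λ (x≢u , x≢v) → from ∈-y⇔ (from ∈-y⇔ (∈⊤ , x≢u) , x≢v))

∣p∣≥1⇒nonempty : ∀ {n} (p : Subset n) → 1 ≤ ∣ p ∣ → Nonempty p
∣p∣≥1⇒nonempty (inside ∷ p)  _ = zero , here
∣p∣≥1⇒nonempty (outside ∷ p) h = let x , x∈ = ∣p∣≥1⇒nonempty p h in suc x , there x∈

∣p∣≥2⇒two-elements : ∀ {n} (p : Subset n) → 2 ≤ ∣ p ∣ → ∃₂ λ x y → x ≢ y × x ∈ p × y ∈ p
∣p∣≥2⇒two-elements (inside ∷ p) (s≤s h) =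
  let x , x∈ = ∣p∣≥1⇒nonempty p h in zero , suc x , (λ ()) , here , there x∈
∣p∣≥2⇒two-elements (outside ∷ p) h =
  let x , y , x≢y , x∈ , y∈ = ∣p∣≥2⇒two-elements p h
  in suc x , suc y , x≢y ∘ suc-injective , there x∈ , there y∈

∈⇔T-lookup : ∀ {n} {p : Subset n} {i} → i ∈ p ⇔ T (lookup p i)
∈⇔T-lookup {p = p} {i} = mk⇔ (from T-≡ ∘ []=⇒lookup) (lookup⇒[]= i p ∘ to T-≡)

∈-tabulate⇔ : ∀ {n} (f : Fin n → Bool) {i} → i ∈ tabulate f ⇔ T (f i)
∈-tabulate⇔ f {i} = mk⇔
  (λ i∈ → subst T (lookup∘tabulate f i) (to ∈⇔T-lookup i∈))
  (λ t → from ∈⇔T-lookup (subst T (sym (lookup∘tabulate f i)) t))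

select : ∀ {n} {P : Fin n → Set} → (∀ i → Dec (P i)) → Subset n
select P? = tabulate λ i → ⌊ P? i ⌋

∈-select⇔ : ∀ {n} {P : Fin n → Set} (P? : ∀ i → Dec (P i)) {i} → i ∈ select P? ⇔ P i
∈-select⇔ P? = mk⇔ (toWitness ∘ to (∈-tabulate⇔ _)) (from (∈-tabulate⇔ _) ∘ fromWitness)

one-of-two-avoids : ∀ {n} {P : Fin n → Set} {a b : Fin n} (w : Fin n) →
                    a ≢ b → P a → P b → ∃[ t ] (P t × t ≢ w)
one-of-two-avoids {a = a} w a≢b Pa Pb with a ≟ w
... | no a≢w   = a , Pa , a≢w
... | yes refl = _ , Pb , ≢-sym a≢b

one-of-three-avoids : ∀ {n} {P : Fin n → Set} {a b c : Fin n} (u v : Fin n) →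
                      a ≢ b → a ≢ c → b ≢ c → P a → P b → P c → ∃[ t ] (P t × t ≢ u × t ≢ v)
one-of-three-avoids {a = a} u v a≢b a≢c b≢c Pa Pb Pc with a ≟ u | a ≟ v
... | no a≢u | no a≢v = a , Pa , a≢u , a≢v
... | yes refl | _ =
  let t , (Pt , t≢a) , t≢v = one-of-two-avoids v b≢c (Pb , ≢-sym a≢b) (Pc , ≢-sym a≢c)
  in t , Pt , t≢a , t≢v
... | no _ | yes refl =
  let t , (Pt , t≢a) , t≢u = one-of-two-avoids u b≢c (Pb , ≢-sym a≢b) (Pc , ≢-sym a≢c)
  in t , Pt , t≢u , t≢a

misses-pair : ∀ {n} {a b u v : Fin n} → a ≢ u × a ≢ v → b ≢ u × b ≢ v →
              ¬ ((a ≡ u ⊎ a ≡ v) ⊎ (b ≡ u ⊎ b ≡ v))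
misses-pair (a≢u , _) _ (inj₁ (inj₁ a≡u)) = a≢u a≡u
misses-pair (_ , a≢v) _ (inj₁ (inj₂ a≡v)) = a≢v a≡v
misses-pair _ (b≢u , _) (inj₂ (inj₁ b≡u)) = b≢u b≡u
misses-pair _ (_ , b≢v) (inj₂ (inj₂ b≡v)) = b≢v b≡v

module _ (H : Graph) where

  ∈edgesIn⇔ : ∀ {VS ES e} → e ∈ edgesIn H VS ES ⇔ EdgeIn H VS ES e
  ∈edgesIn⇔ {VS} {ES} {e} = mk⇔
    (λ e∈ → let (in-ES , ends) = to T-∧ (to (∈-tabulate⇔ _) e∈)
                (in-s , in-t)  = to T-∧ ends
            in from ∈⇔T-lookup in-ES , from ∈⇔T-lookup in-s , from ∈⇔T-lookup in-t)
    (λ (in-ES , in-s , in-t) → from (∈-tabulate⇔ _)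
      (from T-∧ (to ∈⇔T-lookup in-ES , from T-∧ (to ∈⇔T-lookup in-s , to ∈⇔T-lookup in-t))))

  edgesIn-mono : ∀ {VS ES VS′ ES′} → VS ⊆ VS′ → ES ⊆ ES′ → edgesIn H VS ES ⊆ edgesIn H VS′ ES′
  edgesIn-mono VS⊆ ES⊆ e∈ =
    let (in-ES , in-s , in-t) = to ∈edgesIn⇔ e∈ in from ∈edgesIn⇔ (ES⊆ in-ES , VS⊆ in-s , VS⊆ in-t)

module Walks (H : Graph) where
  open Graph H using () renaming (n to N; m to M)

  joins-sym : ∀ {e u w} → Joins H e u w → Joins H e w u
  joins-sym = swap

  edge-in-full : ∀ e → EdgeIn H full full e
  edge-in-full e = ∈⊤ , ∈⊤ , ∈⊤

  module _ {VS : Subset N} {ES : Subset M} where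
    infix 4 _∈ᵥ_ _∈ₑ_ _⊑_ _∈ᵥ?_ _∈ₑ?_

    _∈ᵥ_ : ∀ {x y} → Fin N → Walk H VS ES x y → Set
    t ∈ᵥ here {u} _       = t ≡ u
    t ∈ᵥ step {u} _ _ _ W = t ≡ u ⊎ t ∈ᵥ W

    _∈ₑ_ : ∀ {x y} → Fin M → Walk H VS ES x y → Set
    f ∈ₑ here _       = ⊥
    f ∈ₑ step e _ _ W = f ≡ e ⊎ f ∈ₑ W

    record _⊑_ {x y x′ y′} (W : Walk H VS ES x y) (W′ : Walk H VS ES x′ y′) : Set where
      constructor sub
      field
        nodes⊆ : ∀ t → t ∈ᵥ W → t ∈ᵥ W′
        edges⊆ : ∀ f → f ∈ₑ W → f ∈ₑ W′
    open _⊑_ public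

    IsPath : ∀ {x y} → Walk H VS ES x y → Set
    IsPath (here _)           = ⊤
    IsPath (step {u} _ _ _ W) = ¬ (u ∈ᵥ W) × IsPath W

    _∈ᵥ?_ : ∀ {x y} t (W : Walk H VS ES x y) → Dec (t ∈ᵥ W)
    t ∈ᵥ? here {u} _       = t ≟ u
    t ∈ᵥ? step {u} _ _ _ W = (t ≟ u) ⊎-dec (t ∈ᵥ? W)

    _∈ₑ?_ : ∀ {x y} f (W : Walk H VS ES x y) → Dec (f ∈ₑ W)
    f ∈ₑ? here _       = no λ ()
    f ∈ₑ? step e _ _ W = (f ≟ e) ⊎-dec (f ∈ₑ? W)

    any-node : {P : Fin N → Set} → (∀ t → Dec (P t)) → ∀ {x y} (W : Walk H VS ES x y) →
               (∃[ t ] (t ∈ᵥ W × P t)) ⊎ (∀ t → t ∈ᵥ W → ¬ P t)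
    any-node P? W with any? (λ t → (t ∈ᵥ? W) ×-dec P? t)
    ... | yes found = inj₁ found
    ... | no none   = inj₂ λ t t∈W Pt → none (t , t∈W , Pt)

    start∈ᵥ : ∀ {x y} (W : Walk H VS ES x y) → x ∈ᵥ W
    start∈ᵥ (here _)       = refl
    start∈ᵥ (step _ _ _ _) = inj₁ refl

    end∈ᵥ : ∀ {x y} (W : Walk H VS ES x y) → y ∈ᵥ W
    end∈ᵥ (here _)       = refl
    end∈ᵥ (step _ _ _ W) = inj₂ (end∈ᵥ W)

    start∈VS : ∀ {x y} → Walk H VS ES x y → x ∈ VS
    start∈VS (here x∈)                                 = x∈
    start∈VS (step _ (_ , s∈ , _) (inj₁ (refl , _)) _) = s∈
    start∈VS (step _ (_ , _ , t∈) (inj₂ (_ , refl)) _) = t∈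

    ⊑-refl : ∀ {x y} {W : Walk H VS ES x y} → W ⊑ W
    ⊑-refl = sub (λ _ t∈ → t∈) (λ _ f∈ → f∈)

    ⊑-trans : ∀ {x y x′ y′ x″ y″} {W : Walk H VS ES x y} {W′ : Walk H VS ES x′ y′}
                {W″ : Walk H VS ES x″ y″} → W ⊑ W′ → W′ ⊑ W″ → W ⊑ W″
    ⊑-trans (sub v₁ e₁) (sub v₂ e₂) = sub (λ t → v₂ t ∘ v₁ t) (λ f → e₂ f ∘ e₁ f)

    ⊑-there : ∀ {x y x′ y′ u e ei} {j : Joins H e u x′} {W : Walk H VS ES x y}
                {W′ : Walk H VS ES x′ y′} → W ⊑ W′ → W ⊑ step e ei j W′
    ⊑-there (sub v e) = sub (λ t → inj₂ ∘ v t) (λ f → inj₂ ∘ e f)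

    ⊑-step : ∀ {x y x′ y′ u e ei ei′} {j : Joins H e u x} {j′ : Joins H e u x′}
               {W : Walk H VS ES x y} {W′ : Walk H VS ES x′ y′} →
             W ⊑ W′ → step e ei j W ⊑ step e ei′ j′ W′
    ⊑-step (sub v e) = sub (λ t → Sum.map₂ (v t)) (λ f → Sum.map₂ (e f))

    infixr 5 _++_
    _++_ : ∀ {x y z} → Walk H VS ES x y → Walk H VS ES y z → Walk H VS ES x z
    here _        ++ V = V
    step e ei j W ++ V = step e ei j (W ++ V)

    reverse : ∀ {x y} → Walk H VS ES x y → Walk H VS ES y x
    reverse W = go W (here (start∈VS W))
      where
      go : ∀ {x y z} → Walk H VS ES x y → Walk H VS ES x z → Walk H VS ES y z
      go (here _)        acc = acc
      go (step e ei j W) acc = go W (step e ei (joins-sym j) acc)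

    record Split {x y} (W : Walk H VS ES x y) (z : Fin N) : Set where
      field
        before        : Walk H VS ES x z
        after         : Walk H VS ES z y
        before⊑       : before ⊑ W
        after⊑        : after ⊑ W
        after-path    : IsPath W → IsPath after
        only-z-shared : IsPath W → ∀ t → t ∈ᵥ before → t ∈ᵥ after → t ≡ z

    split : ∀ {x y z} (W : Walk H VS ES x y) → z ∈ᵥ W → Split W z
    split (here x∈) refl = record
      { before = here x∈ ; after = here x∈ ; before⊑ = ⊑-refl ; after⊑ = ⊑-refl
      ; after-path = λ p → p ; only-z-shared = λ _ _ t∈ _ → t∈ }
    split W@(step _ _ _ _) (inj₁ refl) = record
      { before = here (start∈VS W) ; after = W ; before⊑ = sub (λ _ → inj₁) (λ _ ()) ; after⊑ = ⊑-refl
      ; after-path = λ p → p ; only-z-shared = λ _ _ t∈ _ → t∈ }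
    split (step e ei j W) (inj₂ z∈W) = record
      { before = step e ei j before ; after = after ; before⊑ = ⊑-step before⊑ ; after⊑ = ⊑-there after⊑
      ; after-path = after-path ∘ proj₂
      ; only-z-shared = λ { (u∉W , _) t (inj₁ refl) t∈ → ⊥-elim (u∉W (nodes⊆ after⊑ t t∈))
                         ; (_ , W-path) t (inj₂ t∈) t∈′ → only-z-shared W-path t t∈ t∈′ } }
      where open Split (split W z∈W)

    to-path : ∀ {x y} (W : Walk H VS ES x y) → Σ[ P ∈ Walk H VS ES x y ] (IsPath P × P ⊑ W)
    to-path (here x∈) = here x∈ , tt , ⊑-refl
    to-path (step {u} e ei j W) with to-path W
    ... | P , P-path , P⊑W with u ∈ᵥ? P
    ...   | yes u∈P = let open Split (split P u∈P)
                      in after , after-path P-path , ⊑-there (⊑-trans after⊑ P⊑W)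
    ...   | no u∉P  = step e ei j P , (u∉P , P-path) , ⊑-step P⊑W

    path-edge-not-loop : ∀ {x y} (W : Walk H VS ES x y) → IsPath W →
                         ∀ {f} → f ∈ₑ W → src H f ≢ tgt H f
    path-edge-not-loop (step e _ j W) (u∉W , _) (inj₁ refl) loop =
      u∉W (subst (_∈ᵥ W) (loop-ends j loop) (start∈ᵥ W))
      where
      loop-ends : ∀ {u w} → Joins H e u w → src H e ≡ tgt H e → w ≡ u
      loop-ends (inj₁ (refl , refl)) = sym
      loop-ends (inj₂ (refl , refl)) = λ eq → eq
    path-edge-not-loop (step _ _ _ W) (_ , W-path) (inj₂ f∈W) = path-edge-not-loop W W-path f∈W

  mapWalk : ∀ {VS VS′ ES ES′ x y} → VS ⊆ VS′ → ES ⊆ ES′ → Walk H VS ES x y → Walk H VS′ ES′ x y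
  mapWalk VS⊆ ES⊆ (here x∈)                    = here (VS⊆ x∈)
  mapWalk VS⊆ ES⊆ (step e (e∈ , s∈ , t∈) j W) = step e (ES⊆ e∈ , VS⊆ s∈ , VS⊆ t∈) j (mapWalk VS⊆ ES⊆ W)

  restrict : ∀ {VS ES VS′ ES′ x y} (W : Walk H VS ES x y) →
             (∀ t → t ∈ᵥ W → t ∈ VS′) → (∀ f → f ∈ₑ W → f ∈ ES′) → Walk H VS′ ES′ x y
  restrict (here _) in-VS _ = here (in-VS _ refl)
  restrict (step {u} {w} e _ j W) in-VS in-ES =
    step e (in-ES e (inj₁ refl) , ends-in j) j
         (restrict W (λ t → in-VS t ∘ inj₂) (λ f → in-ES f ∘ inj₂))
    where
    ends-in : Joins H e u w → src H e ∈ _ × tgt H e ∈ _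
    ends-in (inj₁ (refl , refl)) = in-VS u (inj₁ refl) , in-VS w (inj₂ (start∈ᵥ W))
    ends-in (inj₂ (refl , refl)) = in-VS w (inj₂ (start∈ᵥ W)) , in-VS u (inj₁ refl)

module _ (G : Graph) {k : ℕ} (φ : Fin (Graph.n G) → Fin k) where

  project : ∀ {VS ES x y} → Walk G VS ES x y → Walk (contract G k φ) full (edgesIn G VS ES) (φ x) (φ y)
  project (here _)        = here ∈⊤
  project (step e e∈ j W) = step e (from (∈edgesIn⇔ G) e∈ , ∈⊤ , ∈⊤) (project-joins j) (project W)
    where
    project-joins : ∀ {a b} → Joins G e a b → Joins (contract G k φ) e (φ a) (φ b)
    project-joins (inj₁ (refl , refl)) = inj₁ (refl , refl)
    project-joins (inj₂ (refl , refl)) = inj₂ (refl , refl)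

-- Blocks of the component graph

module BlockAbsorption (G : Graph) {k : ℕ} (φ : Fin (Graph.n G) → Fin k)
                       {VB : Subset k} {EB : Subset (Graph.m G)} (isB : IsBlock G k φ VB EB) where
  private
    Ĝ : Graph
    Ĝ = contract G k φ
  open Walks Ĝ

  private
    module Extension {c d : Fin k} (Q : Walk Ĝ full full c d) (Q-path : IsPath Q)
                     (c∈VB : c ∈ VB) (d∈VB : d ∈ VB) where
      VB⁺ : Subset k
      VB⁺ = VB ∪ select (_∈ᵥ? Q)

      EB⁺ : Subset (Graph.m G)
      EB⁺ = EB ∪ select (_∈ₑ? Q)

      VB⊆VB⁺ : VB ⊆ VB⁺
      VB⊆VB⁺ = p⊆p∪q _

      EB⊆EB⁺ : EB ⊆ EB⁺
      EB⊆EB⁺ = p⊆p∪q _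

      on-Q⇒∈VB⁺ : ∀ {t} → t ∈ᵥ Q → t ∈ VB⁺
      on-Q⇒∈VB⁺ t∈Q = x∈p∪q⁺ (inj₂ (from (∈-select⇔ (_∈ᵥ? Q)) t∈Q))

      on-Q⇒∈EB⁺ : ∀ {f} → f ∈ₑ Q → f ∈ EB⁺
      on-Q⇒∈EB⁺ f∈Q = x∈p∪q⁺ (inj₂ (from (∈-select⇔ (_∈ₑ? Q)) f∈Q))

      ∈VB⁺⇒ : ∀ {t} → t ∈ VB⁺ → t ∈ VB ⊎ t ∈ᵥ Q
      ∈VB⁺⇒ t∈ = Sum.map₂ (to (∈-select⇔ (_∈ᵥ? Q))) (x∈p∪q⁻ VB _ t∈)

      ∈EB⁺⇒ : ∀ {f} → f ∈ EB⁺ → f ∈ EB ⊎ f ∈ₑ Q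
      ∈EB⁺⇒ f∈ = Sum.map₂ (to (∈-select⇔ (_∈ₑ? Q))) (x∈p∪q⁻ EB _ f∈)

      -- The avoided node (at most one) occurs only once on the path Q, so every node of Q
      -- reaches c or d along Q without passing through it.
      connected-avoiding : (Av : Fin k → Set) → (∀ t → Dec (Av t)) → (∀ {x y} → Av x → Av y → x ≡ y) →
                           (T : Subset k) → (∀ {x} → x ∈ T ⇔ (x ∈ VB⁺ × ¬ Av x)) →
                           (∀ {x y} → x ∈ VB → ¬ Av x → y ∈ VB → ¬ Av y → Walk Ĝ T EB⁺ x y) →
                           Connected Ĝ T EB⁺
      connected-avoiding Av Av? Av-unique T T⇔ within-VB p q p∈T q∈T
        with to-VB p∈T | to-VB q∈T
        where
        along-Q : ∀ {x y} (W : Walk Ĝ full full x y) → W ⊑ Q → (∀ t → t ∈ᵥ W → ¬ Av t) → Walk Ĝ T EB⁺ x y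
        along-Q W W⊑Q avoids = restrict W (λ t t∈W → from T⇔ (on-Q⇒∈VB⁺ (nodes⊆ W⊑Q t t∈W) , avoids t t∈W))
                                          (λ f f∈W → on-Q⇒∈EB⁺ (edges⊆ W⊑Q f f∈W))

        to-VB : ∀ {p} → p ∈ T → ∃[ b ] (b ∈ VB × ¬ Av b × Walk Ĝ T EB⁺ p b)
        to-VB {p} p∈T with ∈VB⁺⇒ (proj₁ (to T⇔ p∈T))
        ... | inj₁ p∈VB = p , p∈VB , proj₂ (to T⇔ p∈T) , here p∈T
        ... | inj₂ p∈Q with split Q p∈Q
        ...   | record { before = before ; after = after ; before⊑ = before⊑ ; after⊑ = after⊑
                       ; only-z-shared = only-p-shared }
                with any-node Av? after | any-node Av? before
        ...     | inj₂ after-free | _ =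
                  d , d∈VB , after-free d (end∈ᵥ after) , along-Q after after⊑ after-free
        ...     | inj₁ _ | inj₂ before-free =
                  c , c∈VB , before-free c (start∈ᵥ before) , reverse (along-Q before before⊑ before-free)
        ...     | inj₁ (t , t∈after , Av-t) | inj₁ (t′ , t′∈before , Av-t′) =
                  ⊥-elim (proj₂ (to T⇔ p∈T)
                    (subst Av (only-p-shared Q-path t (subst (_∈ᵥ before) (Av-unique Av-t′ Av-t) t′∈before)
                                            t∈after) Av-t))
      ... | b , b∈VB , ¬Av-b , p→b | b′ , b′∈VB , ¬Av-b′ , q→b′ =
        p→b ++ within-VB b∈VB ¬Av-b b′∈VB ¬Av-b′ ++ reverse q→b′

      extension-is-candidate : BlockCand G k φ VB⁺ EB⁺
      extension-is-candidate = loop-free , ≤-trans two≤∣VB∣ (p⊆q⇒∣p∣≤∣q∣ VB⊆VB⁺) , connected , no-cut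
        where
        candB : BlockCand G k φ VB EB
        candB = proj₁ isB

        two≤∣VB∣ : 2 ≤ ∣ VB ∣
        two≤∣VB∣ = proj₁ (proj₂ candB)

        connected-VB : Connected Ĝ VB EB
        connected-VB = proj₁ (proj₂ (proj₂ candB))

        no-cut-VB : NoCutVertex Ĝ VB EB
        no-cut-VB = proj₂ (proj₂ (proj₂ candB))

        loop-free : LoopFree G k φ EB⁺
        loop-free e e∈ with ∈EB⁺⇒ e∈
        ... | inj₁ e∈EB = proj₁ candB e e∈EB
        ... | inj₂ e∈Q  = path-edge-not-loop Q Q-path e∈Q

        connected : Connected Ĝ VB⁺ EB⁺
        connected = connected-avoiding (λ _ → ⊥) (λ _ → no λ ()) (λ ()) VB⁺ (mk⇔ (_, λ ()) proj₁)
                      λ x∈ _ y∈ _ → mapWalk VB⊆VB⁺ EB⊆EB⁺ (connected-VB _ _ x∈ y∈)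

        no-cut : NoCutVertex Ĝ VB⁺ EB⁺
        no-cut w _ = connected-avoiding (_≡ w) (_≟ w) (λ x≡w y≡w → trans x≡w (sym y≡w)) (VB⁺ - w) ∈-y⇔
                       around-w
          where
          around-w : ∀ {x y} → x ∈ VB → x ≢ w → y ∈ VB → y ≢ w → Walk Ĝ (VB⁺ - w) EB⁺ x y
          around-w x∈ x≢w y∈ y≢w with w ∈? VB
          ... | yes w∈VB = mapWalk (λ z∈ → let z∈VB , z≢w = to ∈-y⇔ z∈ in from ∈-y⇔ (VB⊆VB⁺ z∈VB , z≢w))
                             EB⊆EB⁺ (no-cut-VB w w∈VB _ _ (from ∈-y⇔ (x∈ , x≢w)) (from ∈-y⇔ (y∈ , y≢w)))
          ... | no w∉VB  = mapWalk (λ z∈ → from ∈-y⇔ (VB⊆VB⁺ z∈ , λ { refl → w∉VB z∈ }))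
                             EB⊆EB⁺ (connected-VB _ _ x∈ y∈)

  paths-stay-in-block : ∀ {c d} (Q : Walk Ĝ full full c d) → IsPath Q → c ∈ VB → d ∈ VB →
                        ∀ {t} → t ∈ᵥ Q → t ∈ VB
  paths-stay-in-block Q Q-path c∈VB d∈VB t∈Q =
    proj₁ (proj₂ isB VB⁺ EB⁺ (VB⊆VB⁺ , edgesIn-mono Ĝ VB⊆VB⁺ EB⊆EB⁺) extension-is-candidate) (on-Q⇒∈VB⁺ t∈Q)
    where open Extension Q Q-path c∈VB d∈VB

module Sides (G : Graph) {k : ℕ} (φ : Fin (Graph.n G) → Fin k)
             {VB : Subset k} {EB : Subset (Graph.m G)} (isB : IsBlock G k φ VB EB)
             {V̂₁ V̂₂ : Subset k} (part : ∀ x → x ∈ VB ⇔ (x ∈ V̂₁ ⊎ x ∈ V̂₂))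
             (disj : ∀ x → ¬ (x ∈ V̂₁ × x ∈ V̂₂)) where
  private
    Ĝ : Graph
    Ĝ = contract G k φ
  open Walks Ĝ
  open BlockAbsorption G φ isB

  Crosses : Fin (Graph.m G) → Set
  Crosses = Crossing G (λ v → φ v ∈ V̂₁) (λ v → φ v ∈ V̂₂)

  Excursion : ∀ {a x} → Walk Ĝ full full a x → Set
  Excursion (here _)         = ⊤
  Excursion (step {a} _ _ _ R) = a ∉ VB × Excursion R

  excursion-nodes : ∀ {a x} (R : Walk Ĝ full full a x) → Excursion R → ∀ t → t ∈ᵥ R → t ∉ VB ⊎ t ≡ x
  excursion-nodes (here _)       _           t t≡x         = inj₂ t≡x
  excursion-nodes (step _ _ _ R) (a∉VB , _)  t (inj₁ refl) = inj₁ a∉VB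
  excursion-nodes (step _ _ _ R) (_ , R-exc) t (inj₂ t∈R)  = excursion-nodes R R-exc t t∈R

  -- Otherwise the excursion would extend to a path between two distinct block nodes
  -- through a node outside the block.
  reentry-point : ∀ {a x a′ e} (R : Walk Ĝ full full a x) → Excursion R → a ∉ VB → x ∈ VB →
                  a′ ∈ VB → Joins Ĝ e a′ a → a′ ≡ x
  reentry-point {x = x} {a′} {e} R R-exc a∉VB x∈VB a′∈VB j with a′ ≟ x | to-path R
  ... | yes a′≡x | _ = a′≡x
  ... | no a′≢x | P , P-path , P⊑R =
    ⊥-elim (a∉VB (paths-stay-in-block (step e (edge-in-full e) j P) (a′∉P , P-path) a′∈VB x∈VB
                                      (inj₂ (start∈ᵥ P))))
    where
    a′∉P : ¬ (a′ ∈ᵥ P)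
    a′∉P a′∈P with excursion-nodes R R-exc a′ (nodes⊆ P⊑R a′ a′∈P)
    ... | inj₁ a′∉VB = a′∉VB a′∈VB
    ... | inj₂ a′≡x  = a′≢x a′≡x

  -- A crossing-free walk from V̂₁ is either in V̂₁, or outside the block with R leading back,
  -- outside the block, to the node x of V̂₁ where it left.
  data Position (a : Fin k) : Set where
    home : a ∈ V̂₁ → Position a
    away : ∀ {x} → x ∈ V̂₁ → a ∉ VB → (R : Walk Ĝ full full a x) → Excursion R → Position a

  crossing-step : ∀ {a a′ e} → a ∈ V̂₁ → a′ ∈ V̂₂ → Joins Ĝ e a a′ → Crosses e
  crossing-step a∈ a′∈ (inj₁ (refl , refl)) = inj₁ (a∈ , a′∈)
  crossing-step a∈ a′∈ (inj₂ (refl , refl)) = inj₂ (a′∈ , a∈)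

  no-crossing-free-walk : ∀ {ES a y} → (∀ {e} → e ∈ ES → ¬ Crosses e) →
                          Walk Ĝ full ES a y → Position a → y ∉ V̂₂
  no-crossing-free-walk _ (here _) (home a∈V̂₁) a∈V̂₂ = disj _ (a∈V̂₁ , a∈V̂₂)
  no-crossing-free-walk _ (here _) (away _ a∉VB _ _) a∈V̂₂ = a∉VB (from (part _) (inj₂ a∈V̂₂))
  no-crossing-free-walk uncrossed (step {w = a′} e (e∈ , _) j W) pos
    with a′ ∈? VB | pos
  ... | yes a′∈VB | home a∈V̂₁ with to (part a′) a′∈VB
  ...   | inj₁ a′∈V̂₁ = no-crossing-free-walk uncrossed W (home a′∈V̂₁)
  ...   | inj₂ a′∈V̂₂ = ⊥-elim (uncrossed e∈ (crossing-step a∈V̂₁ a′∈V̂₂ j))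
  no-crossing-free-walk uncrossed (step e _ j W) _
      | yes a′∈VB | away x∈V̂₁ a∉VB R R-exc
    with reentry-point R R-exc a∉VB (from (part _) (inj₁ x∈V̂₁)) a′∈VB (joins-sym j)
  ... | refl = no-crossing-free-walk uncrossed W (home x∈V̂₁)
  no-crossing-free-walk uncrossed (step e _ j W) _ | no a′∉VB | home a∈V̂₁ =
    no-crossing-free-walk uncrossed W
      (away a∈V̂₁ a′∉VB (step e (edge-in-full e) (joins-sym j) (here ∈⊤)) (a′∉VB , tt))
  no-crossing-free-walk uncrossed (step e _ j W) _ | no a′∉VB | away x∈V̂₁ _ R R-exc =
    no-crossing-free-walk uncrossed W
      (away x∈V̂₁ a′∉VB (step e (edge-in-full e) (joins-sym j) R) (a′∉VB , R-exc))

-- König's theorem for matchings of size three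

module ArcCover {n : ℕ} (R : Fin n → Fin n → Set) (R? : ∀ a b → Dec (R a b))
                (bipartite : ∀ {a b a′ b′} → R a b → R a′ b′ → a ≢ b′) where

  Arc : Set
  Arc = ∃₂ R

  Separate : Arc → Arc → Set
  Separate (a , b , _) (a′ , b′ , _) = a ≢ a′ × b ≢ b′

  ThreeSeparateArcs : Set
  ThreeSeparateArcs = ∃[ α ] ∃[ β ] ∃[ γ ] (Separate α β × Separate α γ × Separate β γ)

  Covers : Fin n → Fin n → Set
  Covers u v = ∀ {a b} → R a b → (a ≡ u ⊎ a ≡ v) ⊎ (b ≡ u ⊎ b ≡ v)

  TwoCover : Set
  TwoCover = ∃₂ λ u v → u ≢ v × Covers u v

  arc? : (P : Fin n → Fin n → Set) → (∀ a b → Dec (P a b)) →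
         (∃₂ λ a b → R a b × P a b) ⊎ (∀ {a b} → R a b → ¬ P a b)
  arc? P P? with any? (λ a → any? λ b → R? a b ×-dec P? a b)
  ... | yes found = inj₁ found
  ... | no none   = inj₂ λ r p → none (_ , _ , r , p)

  covers-by-contradiction : ∀ {u v} → (∀ {a b} → R a b → a ≢ u → a ≢ v → b ≢ u → b ≢ v → ⊥) →
                            Covers u v
  covers-by-contradiction {u} {v} uncovered {a} {b} r with a ≟ u | a ≟ v | b ≟ u | b ≟ v
  ... | yes a≡u | _ | _ | _               = inj₁ (inj₁ a≡u)
  ... | no _ | yes a≡v | _ | _            = inj₁ (inj₂ a≡v)
  ... | no _ | no _ | yes b≡u | _         = inj₂ (inj₁ b≡u)
  ... | no _ | no _ | no _ | yes b≡v      = inj₂ (inj₂ b≡v)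
  ... | no a≢u | no a≢v | no b≢u | no b≢v = ⊥-elim (uncovered r a≢u a≢v b≢u b≢v)

  -- {(a₁,b₁), (a₂,b₂)} is a maximal set of separate arcs; arcs between a₁, a₂ and a head other
  -- than b₁, b₂ (and dually) are where König's alternating paths continue.
  module AroundTwoArcs {a₁ b₁ a₂ b₂} (r₁ : R a₁ b₁) (r₂ : R a₂ b₂) (a₁≢a₂ : a₁ ≢ a₂) (b₁≢b₂ : b₁ ≢ b₂)
                       (meets : ∀ {a b} → R a b → a ≢ a₁ → a ≢ a₂ → b ≢ b₁ → b ≢ b₂ → ⊥) where

    arc-from? : ∀ a → (∃[ b ] (R a b × b ≢ b₁ × b ≢ b₂)) ⊎ (∀ {b} → R a b → b ≢ b₁ → b ≢ b₂ → ⊥)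
    arc-from? a with any? (λ b → R? a b ×-dec ¬? (b ≟ b₁) ×-dec ¬? (b ≟ b₂))
    ... | yes found = inj₁ found
    ... | no none   = inj₂ λ r p q → none (_ , r , p , q)

    arc-into? : ∀ b → (∃[ a ] (R a b × a ≢ a₁ × a ≢ a₂)) ⊎ (∀ {a} → R a b → a ≢ a₁ → a ≢ a₂ → ⊥)
    arc-into? b with any? (λ a → R? a b ×-dec ¬? (a ≟ a₁) ×-dec ¬? (a ≟ a₂))
    ... | yes found = inj₁ found
    ... | no none   = inj₂ λ r p q → none (_ , r , p , q)

    three-arcs : ∀ {x y} → R a₁ x → x ≢ b₁ → x ≢ b₂ → R y b₁ → y ≢ a₁ → y ≢ a₂ → ThreeSeparateArcs
    three-arcs rx x≢b₁ x≢b₂ ry y≢a₁ y≢a₂ =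
      (_ , _ , rx) , (_ , _ , ry) , (_ , _ , r₂) ,
      (≢-sym y≢a₁ , x≢b₁) , (a₁≢a₂ , x≢b₂) , (y≢a₂ , b₁≢b₂)

    tails-cover : (∀ {a} → R a b₁ → a ≢ a₁ → a ≢ a₂ → ⊥) → (∀ {a} → R a b₂ → a ≢ a₁ → a ≢ a₂ → ⊥) →
                  Covers a₁ a₂
    tails-cover ¬into₁ ¬into₂ = covers-by-contradiction uncovered
      where
      uncovered : ∀ {a b} → R a b → a ≢ a₁ → a ≢ a₂ → b ≢ a₁ → b ≢ a₂ → ⊥
      uncovered {b = b} r a≢a₁ a≢a₂ _ _ with b ≟ b₁ | b ≟ b₂
      ... | yes refl | _          = ¬into₁ r a≢a₁ a≢a₂
      ... | no _     | yes refl   = ¬into₂ r a≢a₁ a≢a₂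
      ... | no b≢b₁  | no b≢b₂    = meets r a≢a₁ a≢a₂ b≢b₁ b≢b₂

    heads-cover : (∀ {b} → R a₁ b → b ≢ b₁ → b ≢ b₂ → ⊥) → (∀ {b} → R a₂ b → b ≢ b₁ → b ≢ b₂ → ⊥) →
                  Covers b₁ b₂
    heads-cover ¬from₁ ¬from₂ = covers-by-contradiction uncovered
      where
      uncovered : ∀ {a b} → R a b → a ≢ b₁ → a ≢ b₂ → b ≢ b₁ → b ≢ b₂ → ⊥
      uncovered {a = a} r _ _ b≢b₁ b≢b₂ with a ≟ a₁ | a ≟ a₂
      ... | yes refl | _          = ¬from₁ r b≢b₁ b≢b₂
      ... | no _     | yes refl   = ¬from₂ r b≢b₁ b≢b₂
      ... | no a≢a₁  | no a≢a₂    = meets r a≢a₁ a≢a₂ b≢b₁ b≢b₂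

    mixed : ∀ {x y} → R a₁ x → x ≢ b₁ → x ≢ b₂ → R y b₂ → y ≢ a₁ → y ≢ a₂ →
            (∀ {a} → R a b₁ → a ≢ a₁ → a ≢ a₂ → ⊥) → (∀ {b} → R a₂ b → b ≢ b₁ → b ≢ b₂ → ⊥) →
            ThreeSeparateArcs ⊎ TwoCover
    mixed rx x≢b₁ x≢b₂ ry y≢a₁ y≢a₂ ¬into₁ ¬from₂ with R? a₂ b₁
    ... | yes r = inj₁ ((_ , _ , rx) , (_ , _ , r) , (_ , _ , ry) ,
                        (a₁≢a₂ , x≢b₁) , (≢-sym y≢a₁ , x≢b₂) , (≢-sym y≢a₂ , b₁≢b₂))
    ... | no ¬r = inj₂ (a₁ , b₂ , bipartite r₁ r₂ , covers-by-contradiction uncovered)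
      where
      uncovered : ∀ {a b} → R a b → a ≢ a₁ → a ≢ b₂ → b ≢ a₁ → b ≢ b₂ → ⊥
      uncovered {a} {b} r a≢a₁ _ _ b≢b₂ with a ≟ a₂ | b ≟ b₁
      ... | yes refl | yes refl = ¬r r
      ... | yes refl | no b≢b₁  = ¬from₂ r b≢b₁ b≢b₂
      ... | no a≢a₂  | yes refl = ¬into₁ r a≢a₁ a≢a₂
      ... | no a≢a₂  | no b≢b₁  = meets r a≢a₁ a≢a₂ b≢b₁ b≢b₂

  module _ {a₁ b₁ a₂ b₂} (r₁ : R a₁ b₁) (r₂ : R a₂ b₂) (a₁≢a₂ : a₁ ≢ a₂) (b₁≢b₂ : b₁ ≢ b₂)
           (meets : ∀ {a b} → R a b → a ≢ a₁ → a ≢ a₂ → b ≢ b₁ → b ≢ b₂ → ⊥) where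
    private
      module S₁₂ = AroundTwoArcs r₁ r₂ a₁≢a₂ b₁≢b₂ meets
      module S₂₁ = AroundTwoArcs r₂ r₁ (≢-sym a₁≢a₂) (≢-sym b₁≢b₂) (λ r p q s t → meets r q p t s)

    resolve : ThreeSeparateArcs ⊎ TwoCover
    resolve with S₁₂.arc-from? a₁ | S₁₂.arc-into? b₁ | S₁₂.arc-from? a₂ | S₁₂.arc-into? b₂
    ... | inj₁ (_ , rx , x≢b₁ , x≢b₂) | inj₁ (_ , ry , y≢a₁ , y≢a₂) | _ | _ =
      inj₁ (S₁₂.three-arcs rx x≢b₁ x≢b₂ ry y≢a₁ y≢a₂)
    ... | _ | _ | inj₁ (_ , rx , x≢b₁ , x≢b₂) | inj₁ (_ , ry , y≢a₁ , y≢a₂) =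
      inj₁ (S₂₁.three-arcs rx x≢b₂ x≢b₁ ry y≢a₂ y≢a₁)
    ... | _ | inj₂ ¬into₁ | _ | inj₂ ¬into₂ = inj₂ (a₁ , a₂ , a₁≢a₂ , S₁₂.tails-cover ¬into₁ ¬into₂)
    ... | inj₂ ¬from₁ | _ | inj₂ ¬from₂ | _ = inj₂ (b₁ , b₂ , b₁≢b₂ , S₁₂.heads-cover ¬from₁ ¬from₂)
    ... | inj₁ (_ , rx , x≢b₁ , x≢b₂) | inj₂ ¬into₁ | inj₂ ¬from₂ | inj₁ (_ , ry , y≢a₁ , y≢a₂) =
      S₁₂.mixed rx x≢b₁ x≢b₂ ry y≢a₁ y≢a₂ ¬into₁ ¬from₂
    ... | inj₂ ¬from₁ | inj₁ (_ , ry , y≢a₁ , y≢a₂) | inj₁ (_ , rx , x≢b₁ , x≢b₂) | inj₂ ¬into₂ =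
      S₂₁.mixed rx x≢b₂ x≢b₁ ry y≢a₂ y≢a₁ (λ r p q → ¬into₂ r q p) (λ r p q → ¬from₁ r q p)

  three-separate-arcs-or-two-cover : ∀ {u₀ v₀ : Fin n} → u₀ ≢ v₀ → ThreeSeparateArcs ⊎ TwoCover
  three-separate-arcs-or-two-cover {u₀} {v₀} u₀≢v₀ with arc? (λ _ _ → ⊤) (λ _ _ → yes tt)
  ... | inj₂ no-arc = inj₂ (u₀ , v₀ , u₀≢v₀ , λ r → ⊥-elim (no-arc r tt))
  ... | inj₁ (a₁ , b₁ , r₁ , _) with arc? (λ a b → a ≢ a₁ × b ≢ b₁) (λ a b → ¬? (a ≟ a₁) ×-dec ¬? (b ≟ b₁))
  ...   | inj₂ all-meet =
    inj₂ (a₁ , b₁ , bipartite r₁ r₁ , covers-by-contradiction λ r a≢a₁ _ _ b≢b₁ → all-meet r (a≢a₁ , b≢b₁))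
  ...   | inj₁ (a₂ , b₂ , r₂ , a₂≢a₁ , b₂≢b₁)
    with arc? (λ a b → a ≢ a₁ × a ≢ a₂ × b ≢ b₁ × b ≢ b₂)
              (λ a b → ¬? (a ≟ a₁) ×-dec ¬? (a ≟ a₂) ×-dec ¬? (b ≟ b₁) ×-dec ¬? (b ≟ b₂))
  ...     | inj₁ (_ , _ , r₃ , a₃≢a₁ , a₃≢a₂ , b₃≢b₁ , b₃≢b₂) =
    inj₁ ((_ , _ , r₁) , (_ , _ , r₂) , (_ , _ , r₃) ,
          (≢-sym a₂≢a₁ , ≢-sym b₂≢b₁) , (≢-sym a₃≢a₁ , ≢-sym b₃≢b₁) , (≢-sym a₃≢a₂ , ≢-sym b₃≢b₂))
  ...     | inj₂ none =
    resolve r₁ r₂ (≢-sym a₂≢a₁) (≢-sym b₂≢b₁) λ r p q s t → none r (p , q , s , t)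

module Neighbourhoods (G : Graph) (simple : Simple G) {S : Subset (Graph.m G)} (cover : TwoEdgeCover G S)
                      {k : ℕ} {φ : Fin (Graph.n G) → Fin k} (lab : IsComponentLabelling G S k φ) where
  open Graph G using (n)

  Adjacent : Fin n → Fin n → Set
  Adjacent a b = ∃[ e ] Joins G e a b

  adjacent⇒≢ : ∀ {a b} → Adjacent a b → a ≢ b
  adjacent⇒≢ (e , inj₁ (refl , refl)) = proj₁ simple e
  adjacent⇒≢ (e , inj₂ (refl , refl)) = ≢-sym (proj₁ simple e)

  S-edge-within-component : ∀ {e a b} → e ∈ S → Joins G e a b → φ a ≡ φ b
  S-edge-within-component e∈S j = from (proj₂ lab _ _) (step _ (e∈S , ∈⊤ , ∈⊤) j (here ∈⊤))

  incident-S-edge : ∀ {z e} → e ∈ tabulate (λ e → lookup (edgesIn G full S) e ∧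
                                                     (⌊ src G e ≟ z ⌋ ∨ ⌊ tgt G e ≟ z ⌋)) →
                    e ∈ S × ∃[ x ] Joins G e z x
  incident-S-edge {z} {e} e∈ =
    let in-S , at-z = to T-∧ (to (∈-tabulate⇔ _) e∈)
    in proj₁ (to (∈edgesIn⇔ G {full} {S}) (from ∈⇔T-lookup in-S)) , other-end (to T-∨ at-z)
    where
    other-end : T ⌊ src G e ≟ z ⌋ ⊎ T ⌊ tgt G e ≟ z ⌋ → ∃[ x ] Joins G e z x
    other-end (inj₁ at-src) = tgt G e , inj₁ (toWitness at-src , refl)
    other-end (inj₂ at-tgt) = src G e , inj₂ (refl , toWitness at-tgt)

  record TwoNeighbours (z : Fin n) : Set where
    constructor neighbours
    field
      {x₁ x₂}   : Fin n
      adjacent₁ : Adjacent z x₁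
      adjacent₂ : Adjacent z x₂
      x₁≢x₂     : x₁ ≢ x₂
      same₁     : φ x₁ ≡ φ z
      same₂     : φ x₂ ≡ φ z

  s-neighbours : ∀ z → TwoNeighbours z
  s-neighbours z with ∣p∣≥2⇒two-elements _ (cover z)
  ... | e₁ , e₂ , e₁≢e₂ , e₁∈ , e₂∈ with incident-S-edge e₁∈ | incident-S-edge e₂∈
  ... | e₁∈S , x₁ , j₁ | e₂∈S , x₂ , j₂ =
    neighbours (e₁ , j₁) (e₂ , j₂) (λ { refl → e₁≢e₂ (proj₂ simple e₁ e₂ z x₁ j₁ j₂) })
               (sym (S-edge-within-component e₁∈S j₁)) (sym (S-edge-within-component e₂∈S j₂))

module CrossingMatching
  (G : Graph) (simple : Simple G)
  (no-adjacent-cut : ∀ e → ¬ TwoVertexCut G (src G e) (tgt G e))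
  (cut-shape : ∀ u v → TwoVertexCut G u v → TwoCompsOneSingleton G u v)
  {S : Subset (Graph.m G)} (cover : TwoEdgeCover G S)
  {k : ℕ} {φ : Fin (Graph.n G) → Fin k} (lab : IsComponentLabelling G S k φ)
  {VB : Subset k} {EB : Subset (Graph.m G)} (isB : IsBlock G k φ VB EB)
  {V̂₁ V̂₂ : Subset k} (part : ∀ x → x ∈ VB ⇔ (x ∈ V̂₁ ⊎ x ∈ V̂₂)) (disj : ∀ x → ¬ (x ∈ V̂₁ × x ∈ V̂₂))
  (ne₁ : Nonempty V̂₁) (ne₂ : Nonempty V̂₂) where

  open Graph G using (n; m)
  open Neighbourhoods G simple cover lab
  open Sides G φ isB part disj

  joins? : ∀ e a b → Dec (Joins G e a b)
  joins? e a b = ((src G e ≟ a) ×-dec (tgt G e ≟ b)) ⊎-dec ((src G e ≟ b) ×-dec (tgt G e ≟ a))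

  CrossArc : Fin n → Fin n → Set
  CrossArc a b = ∃[ e ] (Joins G e a b × φ a ∈ V̂₁ × φ b ∈ V̂₂)

  cross-arc? : ∀ a b → Dec (CrossArc a b)
  cross-arc? a b = any? λ e → joins? e a b ×-dec (φ a ∈? V̂₁) ×-dec (φ b ∈? V̂₂)

  sides-differ : ∀ {a b} → φ a ∈ V̂₁ → φ b ∈ V̂₂ → a ≢ b
  sides-differ a∈V̂₁ b∈V̂₂ refl = disj _ (a∈V̂₁ , b∈V̂₂)

  open ArcCover CrossArc cross-arc? (λ (_ , _ , a∈V̂₁ , _) (_ , _ , _ , b′∈V̂₂) → sides-differ a∈V̂₁ b′∈V̂₂)
    public

  arc-edge : Arc → Fin m
  arc-edge (_ , _ , e , _) = e

  arc-crosses : (α : Arc) → Crosses (arc-edge α)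
  arc-crosses (_ , _ , _ , inj₁ (refl , refl) , a∈V̂₁ , b∈V̂₂) = inj₁ (a∈V̂₁ , b∈V̂₂)
  arc-crosses (_ , _ , _ , inj₂ (refl , refl) , a∈V̂₁ , b∈V̂₂) = inj₂ (b∈V̂₂ , a∈V̂₁)

  separate⇒disjoint : (α β : Arc) → Separate α β → Disjoint G (arc-edge α) (arc-edge β)
  separate⇒disjoint (_ , _ , _ , inj₁ (refl , refl) , p , q) (_ , _ , _ , inj₁ (refl , refl) , p′ , q′)
                    (a≢a′ , b≢b′) = a≢a′ , sides-differ p q′ , ≢-sym (sides-differ p′ q) , b≢b′
  separate⇒disjoint (_ , _ , _ , inj₁ (refl , refl) , p , q) (_ , _ , _ , inj₂ (refl , refl) , p′ , q′)
                    (a≢a′ , b≢b′) = sides-differ p q′ , a≢a′ , b≢b′ , ≢-sym (sides-differ p′ q)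
  separate⇒disjoint (_ , _ , _ , inj₂ (refl , refl) , p , q) (_ , _ , _ , inj₁ (refl , refl) , p′ , q′)
                    (a≢a′ , b≢b′) = ≢-sym (sides-differ p′ q) , b≢b′ , a≢a′ , sides-differ p q′
  separate⇒disjoint (_ , _ , _ , inj₂ (refl , refl) , p , q) (_ , _ , _ , inj₂ (refl , refl) , p′ , q′)
                    (a≢a′ , b≢b′) = b≢b′ , ≢-sym (sides-differ p′ q) , sides-differ p q′ , a≢a′

  three-disjoint-crossing-edges : ThreeSeparateArcs →
    ∃[ e₁ ] ∃[ e₂ ] ∃[ e₃ ] (Crosses e₁ × Crosses e₂ × Crosses e₃ ×
                             Disjoint G e₁ e₂ × Disjoint G e₁ e₃ × Disjoint G e₂ e₃)
  three-disjoint-crossing-edges (α , β , γ , αβ , αγ , βγ) =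
    arc-edge α , arc-edge β , arc-edge γ , arc-crosses α , arc-crosses β , arc-crosses γ ,
    separate⇒disjoint α β αβ , separate⇒disjoint α γ αγ , separate⇒disjoint β γ βγ

  separated : (X : Subset n) → (∀ {e} → EdgeIn G X full e → ¬ Crosses e) →
              (∀ c → ∃[ x ] (x ∈ X × φ x ≡ c)) → ¬ Connected G X full
  separated X uncrossed meets connected with meets (proj₁ ne₁) | meets (proj₁ ne₂)
  ... | x , x∈X , φx≡c₁ | y , y∈X , φy≡c₂ =
    no-crossing-free-walk (uncrossed ∘ to (∈edgesIn⇔ G)) (project G φ (connected x y x∈X y∈X))
      (home (subst (_∈ V̂₁) (sym φx≡c₁) (proj₂ ne₁)))
      (subst (_∈ V̂₂) (sym φy≡c₂) (proj₂ ne₂))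

  uncrossed-off-cover : ∀ {u v X} → Covers u v → (∀ {x} → x ∈ X → x ≢ u × x ≢ v) →
                        ∀ {e} → EdgeIn G X full e → ¬ Crosses e
  uncrossed-off-cover cov off (_ , s∈ , t∈) (inj₁ (p , q)) =
    misses-pair (off s∈) (off t∈) (cov (_ , inj₁ (refl , refl) , p , q))
  uncrossed-off-cover cov off (_ , s∈ , t∈) (inj₂ (q , p)) =
    misses-pair (off t∈) (off s∈) (cov (_ , inj₂ (refl , refl) , p , q))

  covers-sym : ∀ {u v} → Covers u v → Covers v u
  covers-sym cov = Sum.map swap swap ∘ cov

  component-avoids-two : ∀ c u v → ∃[ x ] (x ∈ full - u - v × φ x ≡ c)
  component-avoids-two c u v with proj₁ lab c
  ... | z , refl with s-neighbours z
  ... | neighbours adj₁ adj₂ x₁≢x₂ same₁ same₂ =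
    let t , same , t≢u , t≢v =
          one-of-three-avoids {P = λ t → φ t ≡ φ z} u v (adjacent⇒≢ adj₁) (adjacent⇒≢ adj₂) x₁≢x₂
                              refl same₁ same₂
    in t , from ∈⊤-u-v⇔ (t≢u , t≢v) , same

  two-cover-cuts : ∀ {u v} → u ≢ v → Covers u v → TwoVertexCut G u v
  two-cover-cuts u≢v cov =
    u≢v , separated _ (uncrossed-off-cover cov (to ∈⊤-u-v⇔)) (λ c → component-avoids-two c _ _)

  -- The common component of u, v, w keeps a vertex off {u, v, w}: an S-neighbour of u other than w.
  no-singleton-cut : ∀ {u v} → u ≢ v → Covers u v → (∀ e → ¬ Joins G e u v) →
                     TwoCompsOneSingleton G u v → ⊥
  no-singleton-cut {u} {v} u≢v cov ¬uv (w , w≢u , w≢v , w-isolated , _ , connected) =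
    separated (full - u - v - w) (uncrossed-off-cover cov off-uv) avoids-uvw connected
    where
    off-uv : ∀ {x} → x ∈ full - u - v - w → x ≢ u × x ≢ v
    off-uv = to ∈⊤-u-v⇔ ∘ proj₁ ∘ to ∈-y⇔

    neighbour-of-w : ∀ {x} → Adjacent w x → x ≡ u ⊎ x ≡ v
    neighbour-of-w {x} (e , j) with x ≟ u | x ≟ v
    ... | yes x≡u | _       = inj₁ x≡u
    ... | no _    | yes x≡v = inj₂ x≡v
    ... | no x≢u  | no x≢v  = ⊥-elim (w-isolated x e x≢u x≢v (≢-sym (adjacent⇒≢ (e , j))) j)

    u,v∼w : φ u ≡ φ w × φ v ≡ φ w
    u,v∼w with s-neighbours w
    ... | neighbours adj₁ adj₂ x₁≢x₂ same₁ same₂ with neighbour-of-w adj₁ | neighbour-of-w adj₂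
    ...   | inj₁ refl | inj₁ refl = ⊥-elim (x₁≢x₂ refl)
    ...   | inj₁ refl | inj₂ refl = same₁ , same₂
    ...   | inj₂ refl | inj₁ refl = same₂ , same₁
    ...   | inj₂ refl | inj₂ refl = ⊥-elim (x₁≢x₂ refl)

    not-adjacent-to-v : ∀ {x} → Adjacent u x → x ≢ v
    not-adjacent-to-v (e , j) refl = ¬uv e j

    avoids-uvw : ∀ c → ∃[ x ] (x ∈ full - u - v - w × φ x ≡ c)
    avoids-uvw c with c ≟ φ w | proj₁ lab c
    ... | no c≢w | x , φx≡c =
      x , from ∈-y⇔ (from ∈⊤-u-v⇔ (off (proj₁ u,v∼w) , off (proj₂ u,v∼w)) , off refl) , φx≡c
      where
      off : ∀ {y} → φ y ≡ φ w → x ≢ y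
      off φy≡φw refl = c≢w (trans (sym φx≡c) φy≡φw)
    ... | yes refl | _ with s-neighbours u
    ...   | neighbours adj₁ adj₂ x₁≢x₂ same₁ same₂ =
      let t , (t∼u , t≢u , t≢v) , t≢w =
            one-of-two-avoids {P = λ t → φ t ≡ φ u × t ≢ u × t ≢ v} w x₁≢x₂
                              (same₁ , ≢-sym (adjacent⇒≢ adj₁) , not-adjacent-to-v adj₁)
                              (same₂ , ≢-sym (adjacent⇒≢ adj₂) , not-adjacent-to-v adj₂)
      in t , from ∈-y⇔ (from ∈⊤-u-v⇔ (t≢u , t≢v) , t≢w) , trans t∼u (proj₁ u,v∼w)

  no-two-cover : ¬ TwoCover
  no-two-cover (u , v , u≢v , cov) with any? (λ e → joins? e u v)
  ... | yes (e , inj₁ (refl , refl)) = no-adjacent-cut e (two-cover-cuts u≢v cov)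
  ... | yes (e , inj₂ (refl , refl)) = no-adjacent-cut e (two-cover-cuts (≢-sym u≢v) (covers-sym cov))
  ... | no ¬adjacent =
    no-singleton-cut u≢v cov (λ e j → ¬adjacent (e , j)) (cut-shape u v (two-cover-cuts u≢v cov))

  two-distinct-vertices : ∃₂ λ (u v : Fin n) → u ≢ v
  two-distinct-vertices with s-neighbours (proj₁ (proj₁ lab (proj₁ ne₁)))
  ... | neighbours adj₁ _ _ _ _ = _ , _ , adjacent⇒≢ adj₁

lemma7 : (G : Graph) → Structured G 5 4 →
    (S : Subset (Graph.m G)) → TwoEdgeCover G S → Canonical G S →
    (∀ VC → IsComponent G S VC → TwoEC G VC S) →
    (k : ℕ) (φ : Fin (Graph.n G) → Fin k) → IsComponentLabelling G S k φ →
    (VB : Subset k) (EB : Subset (Graph.m G)) → IsBlock G k φ VB EB →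
    (V̂₁ V̂₂ : Subset k) →
    (∀ x → x ∈ VB ⇔ (x ∈ V̂₁ ⊎ x ∈ V̂₂)) → (∀ x → ¬ (x ∈ V̂₁ × x ∈ V̂₂)) →
    Nonempty V̂₁ → Nonempty V̂₂ →
    ∃[ e₁ ] ∃[ e₂ ] ∃[ e₃ ]
      (Crossing G (λ v → φ v ∈ V̂₁) (λ v → φ v ∈ V̂₂) e₁ ×
       Crossing G (λ v → φ v ∈ V̂₁) (λ v → φ v ∈ V̂₂) e₂ ×
       Crossing G (λ v → φ v ∈ V̂₁) (λ v → φ v ∈ V̂₂) e₃ ×
       Disjoint G e₁ e₂ × Disjoint G e₁ e₃ × Disjoint G e₂ e₃)
lemma7 G (simple , _ , _ , _ , no-adjacent-cut , cut-shape) S cover _ _ k φ lab VB EB isB V̂₁ V̂₂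
       part disj ne₁ ne₂ =
  [ three-disjoint-crossing-edges , ⊥-elim ∘ no-two-cover ]
    (three-separate-arcs-or-two-cover (proj₂ (proj₂ two-distinct-vertices)))
  where
  open CrossingMatching G simple no-adjacent-cut cut-shape cover lab isB part disj ne₁ ne₂
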